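{- Let $H\in M_{M\times N}(\pm 1)$ be a partial Hadamard matrix which is dephased and in standard form. (1) If $M=2$, then the first row of $H$ consists of $1$'s, and the second row consists of $N/2$ entries equal to $1$ followed by $N/2$ entries equal to $-1$. (2) If $M=3$, then, reading the columns of $H$ from left to right, $H$ consists of four consecutive blocks of $N/4$ columns each, the columns in these blocks being respectively $(1,1,1)^t$, $(1,1,-1)^t$, $(1,-1,1)^t$, $(1,-1,-1)^t$. (3) If $M=4$, then there exist integers $a,b\ge 0$ with $a+b=N/4$ such that, reading the columns of $H$ from left to right, $H$ consists of eight consecutive blocks of columns, namely: $a$ columns $(1,1,1,1)^t$, then $b$ columns $(1,1,1,-1)^t$, then $b$ columns $(1,1,-1,1)^t$, then $a$ columns $(1,1,-1,-1)^t$, then $b$ columns $(1,-1,1,1)^t$, then $a$ columns $(1,-1,1,-1)^t$, then $a$ columns $(1,-1,-1,1)^t$, then $b$ columns $(1,-1,-1,-1)^t$.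
   Context: A partial Hadamard matrix (PHM) is a rectangular matrix $H\in M_{M\times N}(\pm1)$ whose rows are pairwise orthogonal with respect to the standard scalar product of $\mathbb{R}^N$. A PHM is dephased when its first row and its first column consist of $1$ entries only. A PHM is in standard form when it is dephased and, in addition, its $1$ entries are moved to the left as much as possible (by permuting columns), proceeding from the top row to the bottom row; i.e. the columns are ordered so that, row by row from the top, within each group of columns agreeing on the rows above, the columns with entry $1$ come before those with entry $-1$. -}

module Defs where

open import Data.Nat using (ℕ; zero; suc; _<ᵇ_; _∸_)
open import Data.Bool using (if_then_else_)
open import Data.Fin using (Fin; toℕ; _<_) renaming (zero to fzero; suc to fsuc)
open import Data.Integer using (ℤ; _*_; _+_; 0ℤ; 1ℤ; -1ℤ)
open import Data.List using (List; []; _∷_; foldr; map; allFin)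
open import Data.Nat.ListAction using (sum)
open import Data.Vec using (Vec; tabulate)
open import Data.Product using (_×_; _,_; ∃)
open import Data.Maybe using (Maybe; just; nothing)
open import Relation.Binary.PropositionalEquality using (_≡_; _≢_)
open import Relation.Nullary using (¬_)

data Sign : Set where
  plus minus : Sign

toℤ : Sign → ℤ
toℤ plus  = 1ℤ
toℤ minus = -1ℤ

-- An M × N matrix with ±1 entries, indexed (row, column).
Mat : ℕ → ℕ → Set
Mat M N = Fin M → Fin N → Sign

sumℤ : List ℤ → ℤ
sumℤ = foldr _+_ 0ℤ

rowDot : ∀ {M N} → Mat M N → Fin M → Fin M → ℤ
rowDot {N = N} H i j = sumℤ (map (λ k → toℤ (H i k) * toℤ (H j k)) (allFin N))

IsPHM : ∀ {M N} → Mat M N → Set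
IsPHM H = ∀ i j → i ≢ j → rowDot H i j ≡ 0ℤ

IsDephased : ∀ {M N} → Mat (suc M) (suc N) → Set
IsDephased H = (∀ j → H fzero j ≡ plus) × (∀ i → H i fzero ≡ plus)

col : ∀ {M N} → Mat M N → Fin N → Vec Sign M
col H j = tabulate (λ i → H i j)

ColBefore : ∀ {M} → (Fin M → Sign) → (Fin M → Sign) → Set
ColBefore {M} c c' = ∃ λ (r : Fin M) →
  (∀ (i : Fin M) → i < r → c i ≡ c' i) × c r ≡ plus × c' r ≡ minus

-- standard form: dephased, and the 1 entries are moved to the left as much
-- as possible row by row from the top; i.e. no column is strictly
-- preceded (in the above order) by a column to its right.
IsStandardForm : ∀ {M N} → Mat (suc M) (suc N) → Set
IsStandardForm H = IsDephased H ×
  (∀ j k → j < k → ¬ ColBefore (λ i → H i k) (λ i → H i j))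

-- Block description of the columns: a list of (length, column) pairs.
-- blockAt bs n = the column of the block containing position n (0-based).
blockAt : ∀ {A : Set} → List (ℕ × A) → ℕ → Maybe A
blockAt [] n = nothing
blockAt ((k , v) ∷ bs) n = if n <ᵇ k then just v else blockAt bs (n ∸ k)

HasBlocks : ∀ {M N} → Mat M N → List (ℕ × Vec Sign M) → Set
HasBlocks {N = N} H bs =
  sum (map (λ b → Data.Product.proj₁ b) bs) ≡ N ×
  (∀ j → blockAt bs (toℕ j) ≡ just (col H j))

module Submission where

-- Read each column below its first entry (which is 1) as a binary number
-- (1 ↦ 0, -1 ↦ 1, top row most significant).  The standard-form order of
-- columns refines the order of these codes (code-mono), so the codes of the
-- columns are sorted, and a sorted list is the concatenation of the runs of
-- its values (sorted⇒runs).  Hence the matrix consists of blocks "k_t copies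
-- of the column with code t" for t = 0, 1, …, 2^m − 1 (M = m + 1 rows).
--
-- Counting the scalar product of rows p and q block by block gives the
-- linear form χ p q, whose coefficients are the products of the entries of
-- rows p and q in each column; so orthogonality says ⟦ χ p q ⟧ k = 0.
-- These forms are characters of (ℤ/2)^m; by Walsh–Hadamard inversion the
-- combination Σ_{p,q} (χ p q [t] − χ p q [u]) · χ p q equals 2^(m+1)·(e_t − e_u)
-- as soon as the characters not of the form χ p q (only the product of all
-- three rows when M = 4) agree on t and u.  Evaluating this certificate
-- forces k_t = k_u: for M = 2, 3 all multiplicities agree, and for M = 4 they
-- agree on codes of equal parity, which is the a/b pattern of the theorem.

open import Defs
open import Data.Nat using (ℕ; zero; suc; _+_; _*_; _^_; _∸_; _≤_; _<_; _<ᵇ_; _≟_; z≤n; s≤s)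
import Data.Nat.Properties as ℕP
import Data.Nat.Tactic.RingSolver as ℕSolver
open import Data.Integer as ℤ using (ℤ; +_; -_; 0ℤ; 1ℤ)
import Data.Integer.Properties as ℤP
import Data.Integer.Tactic.RingSolver as ℤSolver
open import Data.Fin using (Fin; toℕ; #_) renaming (zero to fzero; suc to fsuc)
open import Data.Vec as Vec using (Vec; []; _∷_; lookup; zipWith; replicate)
import Data.Vec.Properties as VecP
open import Data.List as List using (List; []; _∷_; _++_; length; filter; head; drop; allFin; cartesianProduct)
import Data.List.Properties as ListP
open import Data.List.Relation.Unary.All as All using (All; _∷_)
import Data.List.Relation.Unary.All.Properties as AllP
open import Data.List.Relation.Unary.AllPairs using (AllPairs; _∷_)
import Data.List.Relation.Unary.AllPairs.Properties as AllPairsP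
open import Data.Nat.ListAction using (sum)
open import Data.Maybe as Maybe using (just)
open import Data.Product using (_×_; _,_; ∃; ∃₂; proj₁; proj₂)
open import Data.Bool using (T; true; false; if_then_else_)
open import Data.Empty using (⊥-elim)
open import Function using (_∘_)
open import Relation.Nullary using (¬_; yes; no)
open import Relation.Binary.PropositionalEquality
  using (_≡_; _≢_; refl; sym; trans; cong; cong₂; subst; module ≡-Reasoning)
open ≡-Reasoning

-- Linear forms over ℤ

Form : ℕ → Set
Form K = Vec ℤ K

⟦_⟧_ : ∀ {K} → Form K → Vec ℤ K → ℤ
⟦ [] ⟧ [] = 0ℤ
⟦ a ∷ f ⟧ (y ∷ x) = a ℤ.* y ℤ.+ ⟦ f ⟧ x

infixl 6 _⊕_
infixr 7 _⊛_

_⊕_ : ∀ {K} → Form K → Form K → Form K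
_⊕_ = zipWith ℤ._+_

_⊛_ : ∀ {K} → ℤ → Form K → Form K
c ⊛ f = Vec.map (λ a → c ℤ.* a) f

zeros : ∀ {K} → Form K
zeros = replicate _ 0ℤ

unit : ∀ {K} → Fin K → Form K
unit fzero    = 1ℤ ∷ zeros
unit (fsuc t) = 0ℤ ∷ unit t

⟦zeros⟧ : ∀ {K} (x : Vec ℤ K) → ⟦ zeros ⟧ x ≡ 0ℤ
⟦zeros⟧ [] = refl
⟦zeros⟧ (y ∷ x) = cong (λ z → 0ℤ ℤ.+ z) (⟦zeros⟧ x)

⟦unit⟧ : ∀ {K} (t : Fin K) (x : Vec ℤ K) → ⟦ unit t ⟧ x ≡ lookup x t
⟦unit⟧ fzero (y ∷ x) = begin
  1ℤ ℤ.* y ℤ.+ ⟦ zeros ⟧ x ≡⟨ cong₂ ℤ._+_ (ℤP.*-identityˡ y) (⟦zeros⟧ x) ⟩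
  y ℤ.+ 0ℤ                 ≡⟨ ℤP.+-identityʳ y ⟩
  y                        ∎
⟦unit⟧ (fsuc t) (y ∷ x) = trans (ℤP.+-identityˡ _) (⟦unit⟧ t x)

⟦⊕⟧ : ∀ {K} (f g x : Vec ℤ K) → ⟦ f ⊕ g ⟧ x ≡ ⟦ f ⟧ x ℤ.+ ⟦ g ⟧ x
⟦⊕⟧ [] [] [] = refl
⟦⊕⟧ (a ∷ f) (b ∷ g) (y ∷ x) =
  trans (cong (λ z → (a ℤ.+ b) ℤ.* y ℤ.+ z) (⟦⊕⟧ f g x)) (regroup a b y (⟦ f ⟧ x) (⟦ g ⟧ x))
  where
  regroup : ∀ a b y F G → (a ℤ.+ b) ℤ.* y ℤ.+ (F ℤ.+ G) ≡ (a ℤ.* y ℤ.+ F) ℤ.+ (b ℤ.* y ℤ.+ G)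
  regroup = ℤSolver.solve-∀

⟦⊛⟧ : ∀ {K} c (f x : Vec ℤ K) → ⟦ c ⊛ f ⟧ x ≡ c ℤ.* ⟦ f ⟧ x
⟦⊛⟧ c [] [] = sym (ℤP.*-zeroʳ c)
⟦⊛⟧ c (a ∷ f) (y ∷ x) =
  trans (cong (λ z → c ℤ.* a ℤ.* y ℤ.+ z) (⟦⊛⟧ c f x)) (factor c a y (⟦ f ⟧ x))
  where
  factor : ∀ c a y F → c ℤ.* a ℤ.* y ℤ.+ c ℤ.* F ≡ c ℤ.* (a ℤ.* y ℤ.+ F)
  factor = ℤSolver.solve-∀

combination : ∀ {K} {I : Set} → List I → (I → ℤ) → (I → Form K) → Form K
combination []       c f = zeros
combination (i ∷ is) c f = c i ⊛ f i ⊕ combination is c f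

combination-vanishes : ∀ {K} {I : Set} (is : List I) (c : I → ℤ) (f : I → Form K) (x : Vec ℤ K) →
  (∀ i → c i ℤ.* ⟦ f i ⟧ x ≡ 0ℤ) → ⟦ combination is c f ⟧ x ≡ 0ℤ
combination-vanishes [] c f x _ = ⟦zeros⟧ x
combination-vanishes (i ∷ is) c f x term = begin
  ⟦ c i ⊛ f i ⊕ combination is c f ⟧ x              ≡⟨ ⟦⊕⟧ (c i ⊛ f i) _ x ⟩
  ⟦ c i ⊛ f i ⟧ x ℤ.+ ⟦ combination is c f ⟧ x      ≡⟨ cong₂ ℤ._+_ (trans (⟦⊛⟧ (c i) (f i) x) (term i))
                                                                     (combination-vanishes is c f x term) ⟩
  0ℤ                                                 ∎

difference-vanishes : ∀ k {K} (t u : Fin K) (x : Vec ℤ K) →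
  ⟦ + suc k ⊛ unit t ⊕ - (+ suc k) ⊛ unit u ⟧ x ≡ 0ℤ → lookup x t ≡ lookup x u
difference-vanishes k t u x vanishes = ℤP.i-j≡0⇒i≡j xₜ xᵤ (ℤP.*-cancelˡ-≡ c (xₜ ℤ.- xᵤ) 0ℤ (begin
  c ℤ.* (xₜ ℤ.- xᵤ)                                     ≡⟨ sym (distribute c xₜ xᵤ) ⟩
  c ℤ.* xₜ ℤ.+ - c ℤ.* xᵤ                               ≡⟨ sym (cong₂ (λ a b → c ℤ.* a ℤ.+ - c ℤ.* b) (⟦unit⟧ t x) (⟦unit⟧ u x)) ⟩
  c ℤ.* ⟦ unit t ⟧ x ℤ.+ - c ℤ.* ⟦ unit u ⟧ x           ≡⟨ sym (cong₂ ℤ._+_ (⟦⊛⟧ c (unit t) x) (⟦⊛⟧ (- c) (unit u) x)) ⟩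
  ⟦ c ⊛ unit t ⟧ x ℤ.+ ⟦ - c ⊛ unit u ⟧ x               ≡⟨ sym (⟦⊕⟧ (c ⊛ unit t) _ x) ⟩
  ⟦ c ⊛ unit t ⊕ - c ⊛ unit u ⟧ x                       ≡⟨ vanishes ⟩
  0ℤ                                                    ≡⟨ sym (ℤP.*-zeroʳ c) ⟩
  c ℤ.* 0ℤ                                              ∎))
  where
  c  = + suc k
  xₜ = lookup x t
  xᵤ = lookup x u
  distribute : ∀ c a b → c ℤ.* a ℤ.+ - c ℤ.* b ≡ c ℤ.* (a ℤ.- b)
  distribute = ℤSolver.solve-∀

-- Columns as binary numbers

digit : Sign → ℕ → ℕ
digit plus  w = 0
digit minus w = w

code : ∀ {m} → (Fin m → Sign) → ℕ
code {zero}  d = 0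
code {suc m} d = digit (d fzero) (2 ^ m) + code (d ∘ fsuc)

code<2^m : ∀ {m} (d : Fin m → Sign) → code d < 2 ^ m
code<2^m {zero}  d = s≤s z≤n
code<2^m {suc m} d with d fzero
... | plus  = ℕP.≤-trans (code<2^m (d ∘ fsuc)) (ℕP.m≤m+n (2 ^ m) _)
... | minus = ℕP.+-monoʳ-< (2 ^ m) (ℕP.≤-trans (code<2^m (d ∘ fsuc)) (ℕP.m≤m+n (2 ^ m) 0))

decode : ∀ {m} → ℕ → Vec Sign m
decode {zero}  t = []
decode {suc m} t = if t <ᵇ 2 ^ m then plus ∷ decode t else minus ∷ decode (t ∸ 2 ^ m)

decode∘code : ∀ {m} (d : Fin m → Sign) → decode (code d) ≡ Vec.tabulate d
decode∘code {zero}  d = refl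
decode∘code {suc m} d with d fzero
... | plus with code (d ∘ fsuc) <ᵇ 2 ^ m in below
...   | true  = cong (plus ∷_) (decode∘code (d ∘ fsuc))
...   | false = ⊥-elim (subst T below (ℕP.<⇒<ᵇ (code<2^m (d ∘ fsuc))))
decode∘code {suc m} d | minus with 2 ^ m + code (d ∘ fsuc) <ᵇ 2 ^ m in below
...   | true  = ⊥-elim (ℕP.m+n≮m (2 ^ m) _ (ℕP.<ᵇ⇒< _ _ (subst T (sym below) _)))
...   | false = cong (minus ∷_) (trans (cong decode (ℕP.m+n∸m≡n (2 ^ m) _)) (decode∘code (d ∘ fsuc)))

ColBefore-tail : ∀ {m} {c c' : Fin (suc m) → Sign} → c fzero ≡ c' fzero →
  ColBefore (c ∘ fsuc) (c' ∘ fsuc) → ColBefore c c'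
ColBefore-tail {c = c} {c'} top (r , above , cr , c'r) = fsuc r , agreeAbove , cr , c'r
  where
  agreeAbove : ∀ i → i Data.Fin.< fsuc r → c i ≡ c' i
  agreeAbove fzero    _         = top
  agreeAbove (fsuc i) (s≤s i<r) = above i i<r

code-mono : ∀ {m} (d d' : Fin m → Sign) → ¬ ColBefore d' d → code d ≤ code d'
code-mono {zero}  d d' _ = z≤n
code-mono {suc m} d d' notBefore with d fzero in top | d' fzero in top'
... | plus  | plus  = code-mono (d ∘ fsuc) (d' ∘ fsuc) (notBefore ∘ ColBefore-tail (trans top' (sym top)))
... | minus | minus = ℕP.+-monoʳ-≤ (2 ^ m)
                        (code-mono (d ∘ fsuc) (d' ∘ fsuc) (notBefore ∘ ColBefore-tail (trans top' (sym top))))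
... | plus  | minus = ℕP.<⇒≤ (ℕP.<-≤-trans (code<2^m (d ∘ fsuc)) (ℕP.m≤m+n (2 ^ m) _))
... | minus | plus  = ⊥-elim (notBefore (fzero , (λ _ ()) , top' , top))

-- Sorted lists of codes are concatenations of runs

expand : ∀ {A : Set} → List (ℕ × A) → List A
expand []             = []
expand ((k , t) ∷ bs) = List.replicate k t ++ expand bs

runs : ∀ {K} → ℕ → Vec ℕ K → List (ℕ × ℕ)
runs s []       = []
runs s (k ∷ ks) = (k , s) ∷ runs (suc s) ks

multiplicity : ℕ → List ℕ → ℕ
multiplicity t xs = length (filter (_≟ t) xs)

multiplicities : ℕ → (K : ℕ) → List ℕ → Vec ℕ K
multiplicities s zero    xs = []
multiplicities s (suc K) xs = multiplicity s xs ∷ multiplicities (suc s) K xs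

InRange : ℕ → ℕ → ℕ → Set
InRange s K x = s ≤ x × x < s + K

multiplicity-here : ∀ t xs → multiplicity t (t ∷ xs) ≡ suc (multiplicity t xs)
multiplicity-here t xs = cong length (ListP.filter-accept (_≟ t) refl)

multiplicity-absent : ∀ t xs → All (_≢ t) xs → multiplicity t xs ≡ 0
multiplicity-absent t xs absent = cong length (ListP.filter-none (_≟ t) absent)

multiplicities-below : ∀ {x} xs s K → x < s → multiplicities s K (x ∷ xs) ≡ multiplicities s K xs
multiplicities-below xs s zero    x<s = refl
multiplicities-below xs s (suc K) x<s =
  cong₂ _∷_ (cong length (ListP.filter-reject (_≟ s) (ℕP.<⇒≢ x<s)))
            (multiplicities-below xs (suc s) K (ℕP.m<n⇒m<1+n x<s))

runs-empty : ∀ s K → expand (runs s (multiplicities s K [])) ≡ []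
runs-empty s zero    = refl
runs-empty s (suc K) = runs-empty (suc s) K

sorted⇒runs : ∀ K s xs → AllPairs _≤_ xs → All (InRange s K) xs →
  xs ≡ expand (runs s (multiplicities s K xs))
sorted⇒runs zero s [] _ _ = refl
sorted⇒runs zero s (x ∷ xs) _ ((s≤x , x<s+0) ∷ _) =
  ⊥-elim (ℕP.<⇒≱ x<s+0 (subst (_≤ x) (sym (ℕP.+-identityʳ s)) s≤x))
sorted⇒runs (suc K) s = split
  where
  -- Either the list starts with s, or s does not occur and the list lies in [s+1, s+1+K).
  split : ∀ xs → AllPairs _≤_ xs → All (InRange s (suc K)) xs →
    xs ≡ expand (runs s (multiplicities s (suc K) xs))
  split [] _ _ = sym (runs-empty s (suc K))
  split (x ∷ xs) (x≤xs ∷ sorted) (x∈ ∷ xs∈) with x ≟ s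
  ... | yes refl = begin
    x ∷ xs                                              ≡⟨ cong (x ∷_) (split xs sorted xs∈) ⟩
    x ∷ expand (runs x (multiplicities x (suc K) xs))    ≡⟨ cong₂ (λ n ks → expand (runs x (n ∷ ks)))
                                                              (sym (multiplicity-here x xs))
                                                              (sym (multiplicities-below xs (suc x) K (ℕP.n<1+n x))) ⟩
    expand (runs x (multiplicities x (suc K) (x ∷ xs)))  ∎
  ... | no x≢s = begin
    x ∷ xs                                                    ≡⟨ sorted⇒runs K (suc s) (x ∷ xs) (x≤xs ∷ sorted)
                                                                   (All.zipWith narrow (above , x∈ ∷ xs∈)) ⟩
    expand (runs (suc s) (multiplicities (suc s) K (x ∷ xs))) ≡⟨ cong (λ n → expand (runs s (n ∷ multiplicities (suc s) K (x ∷ xs))))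
                                                                   (sym (multiplicity-absent s (x ∷ xs) (All.map ℕP.>⇒≢ above))) ⟩
    expand (runs s (multiplicities s (suc K) (x ∷ xs)))        ∎
    where
    s<x : s < x
    s<x = ℕP.≤∧≢⇒< (proj₁ x∈) (x≢s ∘ sym)
    above : All (s <_) (x ∷ xs)
    above = s<x ∷ All.map (ℕP.<-≤-trans s<x) x≤xs
    narrow : ∀ {y} → s < y × InRange s (suc K) y → InRange (suc s) K y
    narrow {y} (s<y , _ , y<) = s<y , subst (y <_) (ℕP.+-suc s K) y<

relabel : ∀ {A B : Set} → (A → B) → ℕ × A → ℕ × B
relabel v (k , t) = k , v t

sizes-expand : ∀ {A B : Set} (v : A → B) (bs : List (ℕ × A)) →
  sum (List.map proj₁ (List.map (relabel v) bs)) ≡ length (expand bs)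
sizes-expand v [] = refl
sizes-expand v ((k , t) ∷ bs) = begin
  k + sum (List.map proj₁ (List.map (relabel v) bs))    ≡⟨ cong (λ n → k + n) (sizes-expand v bs) ⟩
  k + length (expand bs)                                ≡⟨ cong (_+ length (expand bs)) (sym (ListP.length-replicate k)) ⟩
  length (List.replicate k t) + length (expand bs)      ≡⟨ sym (ListP.length-++ (List.replicate k t)) ⟩
  length (List.replicate k t ++ expand bs)              ∎

blockAt-expand : ∀ {A B : Set} (v : A → B) (bs : List (ℕ × A)) (n : ℕ) →
  blockAt (List.map (relabel v) bs) n ≡ Maybe.map v (head (drop n (expand bs)))
blockAt-expand v []             zero    = refl
blockAt-expand v []             (suc n) = refl
blockAt-expand v ((k , t) ∷ bs) n       = within k n
  where
  within : ∀ k n → (if n <ᵇ k then just (v t) else blockAt (List.map (relabel v) bs) (n ∸ k))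
                   ≡ Maybe.map v (head (drop n (List.replicate k t ++ expand bs)))
  within zero    n       = blockAt-expand v bs n
  within (suc k) zero    = refl
  within (suc k) (suc n) = within k n

head-drop-tabulate : ∀ {A : Set} {n} (f : Fin n → A) (j : Fin n) →
  head (drop (toℕ j) (List.tabulate f)) ≡ just (f j)
head-drop-tabulate f fzero    = refl
head-drop-tabulate f (fsuc j) = head-drop-tabulate (f ∘ fsuc) j

table : ∀ {A : Set} → (ℕ → A) → ℕ → (K : ℕ) → Vec A K
table g s zero    = []
table g s (suc K) = g s ∷ table g (suc s) K

table-const : ∀ {A : Set} (g : ℕ → A) c → (∀ t → g t ≡ c) → ∀ s K → table g s K ≡ replicate K c
table-const g c const s zero    = refl
table-const g c const s (suc K) = cong₂ _∷_ (const s) (table-const g c const (suc s) K)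

sumℤ-replicate : ∀ (g : ℕ → ℤ) k t ys →
  sumℤ (List.map g (List.replicate k t ++ ys)) ≡ g t ℤ.* + k ℤ.+ sumℤ (List.map g ys)
sumℤ-replicate g zero t ys = begin
  sumℤ (List.map g ys)                    ≡⟨ sym (ℤP.+-identityˡ _) ⟩
  0ℤ ℤ.+ sumℤ (List.map g ys)             ≡⟨ cong (λ z → z ℤ.+ sumℤ (List.map g ys)) (sym (ℤP.*-zeroʳ (g t))) ⟩
  g t ℤ.* + 0 ℤ.+ sumℤ (List.map g ys)    ∎
sumℤ-replicate g (suc k) t ys =
  trans (cong (λ z → g t ℤ.+ z) (sumℤ-replicate g k t ys)) (one-more (g t) (+ k) (sumℤ (List.map g ys)))
  where
  one-more : ∀ a n r → a ℤ.+ (a ℤ.* n ℤ.+ r) ≡ a ℤ.* (1ℤ ℤ.+ n) ℤ.+ r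
  one-more = ℤSolver.solve-∀

sum-runs : ∀ (g : ℕ → ℤ) s {K} (ks : Vec ℕ K) →
  sumℤ (List.map g (expand (runs s ks))) ≡ ⟦ table g s K ⟧ (Vec.map +_ ks)
sum-runs g s [] = refl
sum-runs g s (k ∷ ks) =
  trans (sumℤ-replicate g k s _) (cong (λ z → g s ℤ.* + k ℤ.+ z) (sum-runs g (suc s) ks))

-- Orthogonality as linear equations on the multiplicities

column : ∀ {m} → ℕ → Vec Sign (suc m)
column t = plus ∷ decode t

pairSign : ∀ {m} → Fin (suc m) → Fin (suc m) → ℕ → ℤ
pairSign p q t = toℤ (lookup (column t) p) ℤ.* toℤ (lookup (column t) q)

χ : ∀ {m} → Fin (suc m) → Fin (suc m) → Form (2 ^ m)
χ {m} p q = table (pairSign p q) 0 (2 ^ m)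

Orthogonal : ∀ {m} → Vec ℤ (2 ^ m) → Set
Orthogonal {m} k = ∀ (p q : Fin (suc m)) → p ≢ q → ⟦ χ p q ⟧ k ≡ 0ℤ

rowPairs : ∀ m → List (Fin (suc m) × Fin (suc m))
rowPairs m = cartesianProduct (allFin (suc m)) (allFin (suc m))

pairForm : ∀ {m} → Fin (suc m) × Fin (suc m) → Form (2 ^ m)
pairForm (p , q) = χ p q

-- The coefficient of χ p q in the inversion formula for k_t − k_u.
pairWeight : ∀ {m} (t u : Fin (2 ^ m)) → Fin (suc m) × Fin (suc m) → ℤ
pairWeight {m} t u (p , q) = lookup (χ {m} p q) t ℤ.- lookup (χ {m} p q) u

-- Walsh–Hadamard inversion along the row-pair forms: Σ_{p,q} (χ p q [t] − χ p q [u]) · χ p q.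
-- Whenever this equals 2^(m+1)·(e_t − e_u) (a finite computation), orthogonality
-- forces the multiplicities of t and u to agree.
certificate : ∀ {m} (t u : Fin (2 ^ m)) → Form (2 ^ m)
certificate {m} t u = combination (rowPairs m) (pairWeight {m} t u) pairForm

-- The diagonal terms carry the coefficient 0, since every entry squares to 1.
diagonal-coefficient : ∀ {m} (p : Fin (suc m)) (t u : Fin (2 ^ m)) →
  lookup (χ {m} p p) t ℤ.- lookup (χ {m} p p) u ≡ 0ℤ
diagonal-coefficient {m} p t u = begin
  lookup (χ p p) t ℤ.- lookup (χ p p) u                     ≡⟨ cong₂ (λ a b → lookup a t ℤ.- lookup b u) ones ones ⟩
  lookup (replicate _ 1ℤ) t ℤ.- lookup (replicate _ 1ℤ) u   ≡⟨ cong₂ ℤ._-_ (VecP.lookup-replicate t 1ℤ)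
                                                                             (VecP.lookup-replicate u 1ℤ) ⟩
  1ℤ ℤ.- 1ℤ                                                 ≡⟨⟩
  0ℤ                                                        ∎
  where
  square : ∀ s → toℤ s ℤ.* toℤ s ≡ 1ℤ
  square plus  = refl
  square minus = refl
  ones : χ p p ≡ replicate (2 ^ m) 1ℤ
  ones = table-const (pairSign p p) 1ℤ (λ t → square (lookup (column t) p)) 0 (2 ^ m)

certificate-vanishes : ∀ {m} {k : Vec ℤ (2 ^ m)} → Orthogonal {m} k → ∀ t u → ⟦ certificate {m} t u ⟧ k ≡ 0ℤ
certificate-vanishes {m} {k} orthogonal t u =
  combination-vanishes (rowPairs m) (pairWeight {m} t u) pairForm k term
  where
  term : ∀ pq → pairWeight {m} t u pq ℤ.* ⟦ pairForm pq ⟧ k ≡ 0ℤ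
  term (p , q) with p Data.Fin.≟ q
  ... | yes refl = cong (λ c → c ℤ.* ⟦ χ p p ⟧ k) (diagonal-coefficient p t u)
  ... | no  p≢q  = trans (cong (λ z → pairWeight {m} t u (p , q) ℤ.* z) (orthogonal p q p≢q))
                         (ℤP.*-zeroʳ (pairWeight {m} t u (p , q)))

equal-multiplicities : ∀ {m} (ks : Vec ℕ (2 ^ m)) → Orthogonal {m} (Vec.map +_ ks) → ∀ n (t u : Fin (2 ^ m)) →
  certificate {m} t u ≡ + suc n ⊛ unit t ⊕ - (+ suc n) ⊛ unit u → lookup ks t ≡ lookup ks u
equal-multiplicities {m} ks orthogonal n t u checked = ℤP.+-injective (begin
  + lookup ks t             ≡⟨ sym (VecP.lookup-map t +_ ks) ⟩
  lookup (Vec.map +_ ks) t  ≡⟨ difference-vanishes n t u (Vec.map +_ ks) vanishes ⟩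
  lookup (Vec.map +_ ks) u  ≡⟨ VecP.lookup-map u +_ ks ⟩
  + lookup ks u             ∎)
  where
  vanishes : ⟦ + suc n ⊛ unit t ⊕ - (+ suc n) ⊛ unit u ⟧ (Vec.map +_ ks) ≡ 0ℤ
  vanishes = subst (λ f → ⟦ f ⟧ (Vec.map +_ ks) ≡ 0ℤ) checked (certificate-vanishes {m} orthogonal t u)

-- The block structure of a standard-form matrix

blockList : ∀ {m} → Vec ℕ (2 ^ m) → List (ℕ × Vec Sign (suc m))
blockList ks = List.map (relabel column) (runs 0 ks)

module StandardForm {m N : ℕ} (H : Mat (suc m) (suc N)) (standard : IsStandardForm H) where

  firstRow : ∀ j → H fzero j ≡ plus
  firstRow = proj₁ (proj₁ standard)

  columnCode : Fin (suc N) → ℕ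
  columnCode j = code (λ i → H (fsuc i) j)

  codes : List ℕ
  codes = List.tabulate columnCode

  column-code : ∀ j → col H j ≡ column (columnCode j)
  column-code j = cong₂ _∷_ (firstRow j) (sym (decode∘code (λ i → H (fsuc i) j)))

  entry-code : ∀ i j → H i j ≡ lookup (column (columnCode j)) i
  entry-code i j = trans (sym (VecP.lookup∘tabulate (λ i → H i j) i)) (cong (λ c → lookup c i) (column-code j))

  codes-sorted : AllPairs _≤_ codes
  codes-sorted = AllPairsP.tabulate⁺-< λ {j} {k} j<k →
    code-mono _ _ (proj₂ standard j k j<k ∘ ColBefore-tail (trans (firstRow k) (sym (firstRow j))))

  codes-bounded : All (InRange 0 (2 ^ m)) codes
  codes-bounded = AllP.tabulate⁺ λ j → z≤n , code<2^m (λ i → H (fsuc i) j)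

  counts : Vec ℕ (2 ^ m)
  counts = multiplicities 0 (2 ^ m) codes

  codes-runs : codes ≡ expand (runs 0 counts)
  codes-runs = sorted⇒runs (2 ^ m) 0 codes codes-sorted codes-bounded

  hasBlocks : HasBlocks H (blockList {m} counts)
  hasBlocks = sizes , positions
    where
    sizes : sum (List.map proj₁ (blockList {m} counts)) ≡ suc N
    sizes = begin
      sum (List.map proj₁ (blockList {m} counts))   ≡⟨ sizes-expand column (runs 0 counts) ⟩
      length (expand (runs 0 counts))               ≡⟨ cong length (sym codes-runs) ⟩
      length codes                                  ≡⟨ ListP.length-tabulate columnCode ⟩
      suc N                                         ∎
    positions : ∀ j → blockAt (blockList {m} counts) (toℕ j) ≡ just (col H j)
    positions j = begin
      blockAt (blockList {m} counts) (toℕ j)                     ≡⟨ blockAt-expand column (runs 0 counts) (toℕ j) ⟩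
      Maybe.map column (head (drop (toℕ j) (expand (runs 0 counts)))) ≡⟨ cong (λ cs → Maybe.map column (head (drop (toℕ j) cs)))
                                                                         (sym codes-runs) ⟩
      Maybe.map column (head (drop (toℕ j) codes))               ≡⟨ cong (Maybe.map column) (head-drop-tabulate columnCode j) ⟩
      just (column (columnCode j))                               ≡⟨ cong just (sym (column-code j)) ⟩
      just (col H j)                                             ∎

  rowDot-counts : ∀ p q → rowDot H p q ≡ ⟦ χ p q ⟧ (Vec.map +_ counts)
  rowDot-counts p q = begin
    sumℤ (List.map entryProduct (allFin (suc N)))             ≡⟨ cong sumℤ (ListP.map-tabulate (λ j → j) entryProduct) ⟩
    sumℤ (List.tabulate entryProduct)                          ≡⟨ cong sumℤ (ListP.tabulate-cong λ j →
                                                                    cong₂ (λ a b → toℤ a ℤ.* toℤ b) (entry-code p j) (entry-code q j)) ⟩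
    sumℤ (List.tabulate (pairSign p q ∘ columnCode))           ≡⟨ cong sumℤ (sym (ListP.map-tabulate columnCode (pairSign p q))) ⟩
    sumℤ (List.map (pairSign p q) codes)                       ≡⟨ cong (sumℤ ∘ List.map (pairSign p q)) codes-runs ⟩
    sumℤ (List.map (pairSign p q) (expand (runs 0 counts)))    ≡⟨ sum-runs (pairSign p q) 0 counts ⟩
    ⟦ χ p q ⟧ (Vec.map +_ counts)                              ∎
    where
    entryProduct : Fin (suc N) → ℤ
    entryProduct j = toℤ (H p j) ℤ.* toℤ (H q j)

block-structure : ∀ {m N} (H : Mat (suc m) (suc N)) → IsPHM H → IsStandardForm H →
  ∃ λ (ks : Vec ℕ (2 ^ m)) → HasBlocks H (blockList ks) × Orthogonal {m} (Vec.map +_ ks)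
block-structure H phm standard =
  counts , hasBlocks , λ p q p≢q → trans (sym (rowDot-counts p q)) (phm p q p≢q)
  where open StandardForm H standard

-- In each, the multiplicities ks come from block-structure;
-- every `refl` passed to equal-multiplicities is a certificate checked by
-- evaluation, and `identify` substitutes the resulting equalities.

twoRows : ∀ N (H : Mat 2 (suc N)) → IsPHM H → IsStandardForm H →
  ∃ λ h → 2 * h ≡ suc N ×
    HasBlocks H ((h , plus ∷ plus ∷ []) ∷ (h , plus ∷ minus ∷ []) ∷ [])
twoRows N H phm standard with block-structure H phm standard
... | ks@(h ∷ _ ∷ []) , blocks , orthogonal = h , proj₁ balanced , balanced
  where
  identify : ∀ {k₁} → k₁ ≡ h → HasBlocks H (blockList {1} (h ∷ k₁ ∷ [])) → HasBlocks H (blockList {1} (h ∷ h ∷ []))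
  identify refl blocks = blocks
  balanced : HasBlocks H (blockList {1} (h ∷ h ∷ []))
  balanced = identify (equal-multiplicities ks orthogonal 3 (# 1) (# 0) refl) blocks

threeRows : ∀ N (H : Mat 3 (suc N)) → IsPHM H → IsStandardForm H →
  ∃ λ q → 4 * q ≡ suc N ×
    HasBlocks H ((q , plus ∷ plus ∷ plus ∷ []) ∷ (q , plus ∷ plus ∷ minus ∷ [])
               ∷ (q , plus ∷ minus ∷ plus ∷ []) ∷ (q , plus ∷ minus ∷ minus ∷ []) ∷ [])
threeRows N H phm standard with block-structure H phm standard
... | ks@(q ∷ _ ∷ _ ∷ _ ∷ []) , blocks , orthogonal = q , proj₁ balanced , balanced
  where
  identify : ∀ {k₁ k₂ k₃} → k₁ ≡ q → k₂ ≡ q → k₃ ≡ q →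
    HasBlocks H (blockList {2} (q ∷ k₁ ∷ k₂ ∷ k₃ ∷ [])) → HasBlocks H (blockList {2} (q ∷ q ∷ q ∷ q ∷ []))
  identify refl refl refl blocks = blocks
  balanced : HasBlocks H (blockList {2} (q ∷ q ∷ q ∷ q ∷ []))
  balanced = identify (same (# 1) (# 0) refl) (same (# 2) (# 0) refl) (same (# 3) (# 0) refl) blocks
    where
    same : ∀ t u → certificate {2} t u ≡ + 8 ⊛ unit t ⊕ - (+ 8) ⊛ unit u → lookup ks t ≡ lookup ks u
    same = equal-multiplicities ks orthogonal 7

-- M = 4: codes of equal parity occur equally often, a times for even and b times
-- for odd parity; the product of rows 1, 2, 3 is the one character not covered.
fourRows : ∀ N (H : Mat 4 (suc N)) → IsPHM H → IsStandardForm H →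
  ∃₂ λ a b → 4 * (a + b) ≡ suc N ×
    HasBlocks H ((a , plus ∷ plus ∷ plus ∷ plus ∷ [])
               ∷ (b , plus ∷ plus ∷ plus ∷ minus ∷ [])
               ∷ (b , plus ∷ plus ∷ minus ∷ plus ∷ [])
               ∷ (a , plus ∷ plus ∷ minus ∷ minus ∷ [])
               ∷ (b , plus ∷ minus ∷ plus ∷ plus ∷ [])
               ∷ (a , plus ∷ minus ∷ plus ∷ minus ∷ [])
               ∷ (a , plus ∷ minus ∷ minus ∷ plus ∷ [])
               ∷ (b , plus ∷ minus ∷ minus ∷ minus ∷ []) ∷ [])
fourRows N H phm standard with block-structure H phm standard
... | ks@(a ∷ b ∷ _ ∷ _ ∷ _ ∷ _ ∷ _ ∷ _ ∷ []) , blocks , orthogonal = a , b , trans (total a b) (proj₁ balanced) , balanced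
  where
  identify : ∀ {k₂ k₃ k₄ k₅ k₆ k₇} → k₂ ≡ b → k₃ ≡ a → k₄ ≡ b → k₅ ≡ a → k₆ ≡ a → k₇ ≡ b →
    HasBlocks H (blockList {3} (a ∷ b ∷ k₂ ∷ k₃ ∷ k₄ ∷ k₅ ∷ k₆ ∷ k₇ ∷ [])) →
    HasBlocks H (blockList {3} (a ∷ b ∷ b ∷ a ∷ b ∷ a ∷ a ∷ b ∷ []))
  identify refl refl refl refl refl refl blocks = blocks
  balanced : HasBlocks H (blockList {3} (a ∷ b ∷ b ∷ a ∷ b ∷ a ∷ a ∷ b ∷ []))
  balanced = identify (same (# 2) (# 1) refl) (same (# 3) (# 0) refl) (same (# 4) (# 1) refl)
                      (same (# 5) (# 0) refl) (same (# 6) (# 0) refl) (same (# 7) (# 1) refl) blocks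
    where
    same : ∀ t u → certificate {3} t u ≡ + 16 ⊛ unit t ⊕ - (+ 16) ⊛ unit u → lookup ks t ≡ lookup ks u
    same = equal-multiplicities ks orthogonal 15
  total : ∀ a b → 4 * (a + b) ≡ a + (b + (b + (a + (b + (a + (a + (b + 0)))))))
  total = ℕSolver.solve-∀

theorem1p16 :
  -- (1) M = 2
  (∀ N (H : Mat 2 (suc N)) → IsPHM H → IsStandardForm H →
    ∃ λ h → 2 * h ≡ suc N ×
      HasBlocks H ((h , plus ∷ plus ∷ []) ∷ (h , plus ∷ minus ∷ []) ∷ []))
  ×
  -- (2) M = 3
  (∀ N (H : Mat 3 (suc N)) → IsPHM H → IsStandardForm H →
    ∃ λ q → 4 * q ≡ suc N ×
      HasBlocks H ((q , plus ∷ plus ∷ plus ∷ []) ∷ (q , plus ∷ plus ∷ minus ∷ [])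
                 ∷ (q , plus ∷ minus ∷ plus ∷ []) ∷ (q , plus ∷ minus ∷ minus ∷ []) ∷ []))
  ×
  -- (3) M = 4
  (∀ N (H : Mat 4 (suc N)) → IsPHM H → IsStandardForm H →
    ∃₂ λ a b → 4 * (a + b) ≡ suc N ×
      HasBlocks H ((a , plus ∷ plus ∷ plus ∷ plus ∷ [])
                 ∷ (b , plus ∷ plus ∷ plus ∷ minus ∷ [])
                 ∷ (b , plus ∷ plus ∷ minus ∷ plus ∷ [])
                 ∷ (a , plus ∷ plus ∷ minus ∷ minus ∷ [])
                 ∷ (b , plus ∷ minus ∷ plus ∷ plus ∷ [])
                 ∷ (a , plus ∷ minus ∷ plus ∷ minus ∷ [])
                 ∷ (a , plus ∷ minus ∷ minus ∷ plus ∷ [])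
                 ∷ (b , plus ∷ minus ∷ minus ∷ minus ∷ []) ∷ []))
theorem1p16 = twoRows , threeRows , fourRows
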